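{- Let $m,n\ge 3$ be integers. Then the pair $(C_m,C_n)$ is niche-realizable if and only if $(m,n)\in\{(3,3),(3,4),(4,3),(4,4)\}$.
   Context: $C_k$ denotes the cycle on $k$ vertices. The niche graph of a digraph $D$ is the simple graph with vertex set $V(D)$ in which distinct $u,v$ are adjacent iff there is a vertex $w$ with $(u,w),(v,w)\in A(D)$, or with $(w,u),(w,v)\in A(D)$. For graphs $G_1,G_2$ with $m$ and $n$ vertices, the pair $(G_1,G_2)$ is niche-realizable if the disjoint union of $G_1$ and $G_2$ is the niche graph of an orientation of $K_{m,n}$ with bipartition $(V(G_1),V(G_2))$. -}

module Defs where

open import Data.Nat using (ℕ; suc)
open import Data.Fin using (Fin; toℕ)
open import Data.Bool using (Bool; true; false)
open import Data.Sum using (_⊎_; inj₁; inj₂)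
open import Data.Product using (_×_; ∃; ∃-syntax)
open import Data.Empty using (⊥)
open import Relation.Binary.PropositionalEquality using (_≡_; _≢_)
open import Function.Bundles using (_⇔_)

Graph : Set → Set₁
Graph V = V → V → Set

-- The cycle C_k on vertex set Fin k (vertices 0,1,…,k-1 in cyclic order):
-- i ~ j iff j = i+1, or i = j+1, or {i,j} = {0,k-1}.  (For k ≥ 3 this is C_k.)
Cycle : (k : ℕ) → Graph (Fin k)
Cycle k i j =
  (suc (toℕ i) ≡ toℕ j) ⊎ (suc (toℕ j) ≡ toℕ i)
  ⊎ (toℕ i ≡ 0 × suc (toℕ j) ≡ k) ⊎ (toℕ j ≡ 0 × suc (toℕ i) ≡ k)

DisjointUnion : {V₁ V₂ : Set} → Graph V₁ → Graph V₂ → Graph (V₁ ⊎ V₂)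
DisjointUnion G₁ G₂ (inj₁ a) (inj₁ b) = G₁ a b
DisjointUnion G₁ G₂ (inj₂ a) (inj₂ b) = G₂ a b
DisjointUnion G₁ G₂ (inj₁ _) (inj₂ _) = ⊥
DisjointUnion G₁ G₂ (inj₂ _) (inj₁ _) = ⊥

-- An orientation of K_{m,n} with parts Fin m and Fin n:
-- o i j ≡ true means the arc i → j, false means the arc j → i.
Orientation : ℕ → ℕ → Set
Orientation m n = Fin m → Fin n → Bool

Arc : {m n : ℕ} → Orientation m n → Fin m ⊎ Fin n → Fin m ⊎ Fin n → Set
Arc o (inj₁ i) (inj₂ j) = o i j ≡ true
Arc o (inj₂ j) (inj₁ i) = o i j ≡ false
Arc o (inj₁ _) (inj₁ _) = ⊥
Arc o (inj₂ _) (inj₂ _) = ⊥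

NicheGraph : {V : Set} → (V → V → Set) → Graph V
NicheGraph {V} A u v =
  u ≢ v × ((∃[ w ] (A u w × A v w)) ⊎ (∃[ w ] (A w u × A w v)))

NicheRealizable : {m n : ℕ} → Graph (Fin m) → Graph (Fin n) → Set
NicheRealizable {m} {n} G₁ G₂ =
  ∃[ o ] (∀ (u v : Fin m ⊎ Fin n) →
           NicheGraph (Arc {m} {n} o) u v ⇔ DisjointUnion G₁ G₂ u v)

-- Two vertices on the same side of K_{m,n} are niche-adjacent exactly when
-- their rows (columns, on the second side) of the 0/1 orientation matrix
-- agree in some coordinate, so a non-adjacent pair has complementary rows.
-- In a cycle with at least five vertices the non-adjacent pairs 0–2, 0–3 and
-- 1–3 then force rows 1 and 2 to be complementary, contradicting the edge
-- 1–2.  The four small cases are realized by explicit orientations, checked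
-- by a decision procedure.
module Submission where

open import Defs
open import Data.Nat using (ℕ; _≤_; suc; s≤s)
open import Data.Nat.Properties using (≰⇒>; ≤-antisym; ≤-pred; m≤n⇒m<n∨m≡n)
import Data.Nat as ℕ
open import Data.Sum using (_⊎_; inj₁; inj₂)
open import Data.Product using (_×_; _,_; ∃-syntax)
open import Data.Bool using (Bool; true; false; not)
open import Data.Bool.Properties using (¬-not; not-¬) renaming (_≟_ to _≟ᵇ_)
open import Data.Fin using (Fin; toℕ; #_)
open import Data.Fin.Properties using (any?; all?) renaming (_≟_ to _≟ᶠ_)
open import Data.Vec using (Vec; []; _∷_; lookup)
open import Data.Empty using (⊥-elim)
open import Function using (flip; _∘_)
open import Function.Bundles using (_⇔_; mk⇔; module Equivalence)
open import Function.Construct.Composition using (_⇔-∘_)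
open import Function.Construct.Symmetry using (⇔-sym)
open import Relation.Nullary using (Dec; ¬_)
open import Relation.Binary using (Decidable)
open import Relation.Nullary.Decidable
  using (True; toWitness; map′; decidable-stable; ¬?; _×-dec_; _⊎-dec_; _→-dec_)
open import Relation.Binary.PropositionalEquality
  using (_≡_; _≢_; refl; sym; trans; cong)

open Equivalence

private
  variable
    A B : Set
    m n : ℕ

Agree : (A → B → Bool) → A → A → Set
Agree f a b = a ≢ b × ∃[ y ] f a y ≡ f b y

AgreementGraph : (A → B → Bool) → Graph A → Set
AgreementGraph f G = ∀ a b → Agree f a b ⇔ G a b

Complementary : (A → B → Bool) → A → A → Set
Complementary f a b = ∀ y → f a y ≡ not (f b y)

¬Agree⇒Complementary : {f : A → B → Bool} {a b : A} →
  a ≢ b → ¬ Agree f a b → Complementary f a b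
¬Agree⇒Complementary a≢b ¬agree y = ¬-not (λ e → ¬agree (a≢b , y , e))

Agree⇒¬Complementary : {f : A → B → Bool} {a b : A} →
  Agree f a b → ¬ Complementary f a b
Agree⇒¬Complementary (_ , y , e) complementary = not-¬ e (complementary y)

complementary-zigzag : {f : A → B → Bool} {a b c d : A} →
  Complementary f a c → Complementary f a d → Complementary f b d →
  Complementary f b c
complementary-zigzag ac ad bd y = trans (bd y) (trans (sym (ad y)) (ac y))

niche-inj₁ : (o : Orientation m n) (a b : Fin m) →
  NicheGraph (Arc o) (inj₁ a) (inj₁ b) ⇔ Agree o a b
niche-inj₁ o a b = mk⇔ to′ from′
  where
  to′ : NicheGraph (Arc o) (inj₁ a) (inj₁ b) → Agree o a b
  to′ (u≢v , inj₁ (inj₂ y , p , q)) = u≢v ∘ cong inj₁ , y , trans p (sym q)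
  to′ (u≢v , inj₂ (inj₂ y , p , q)) = u≢v ∘ cong inj₁ , y , trans p (sym q)
  from′ : Agree o a b → NicheGraph (Arc o) (inj₁ a) (inj₁ b)
  from′ (a≢b , y , e) = (λ { refl → a≢b refl }) , common-neighbour (o a y) refl
    where
    common-neighbour : ∀ v → o a y ≡ v →
      (∃[ w ] (Arc o (inj₁ a) w × Arc o (inj₁ b) w)) ⊎
      (∃[ w ] (Arc o w (inj₁ a) × Arc o w (inj₁ b)))
    common-neighbour true  p = inj₁ (inj₂ y , p , trans (sym e) p)
    common-neighbour false p = inj₂ (inj₂ y , p , trans (sym e) p)

niche-inj₂ : (o : Orientation m n) (x y : Fin n) →
  NicheGraph (Arc o) (inj₂ x) (inj₂ y) ⇔ Agree (flip o) x y
niche-inj₂ o x y = mk⇔ to′ from′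
  where
  to′ : NicheGraph (Arc o) (inj₂ x) (inj₂ y) → Agree (flip o) x y
  to′ (u≢v , inj₁ (inj₁ i , p , q)) = u≢v ∘ cong inj₂ , i , trans p (sym q)
  to′ (u≢v , inj₂ (inj₁ i , p , q)) = u≢v ∘ cong inj₂ , i , trans p (sym q)
  from′ : Agree (flip o) x y → NicheGraph (Arc o) (inj₂ x) (inj₂ y)
  from′ (x≢y , i , e) = (λ { refl → x≢y refl }) , common-neighbour (o i x) refl
    where
    common-neighbour : ∀ v → o i x ≡ v →
      (∃[ w ] (Arc o (inj₂ x) w × Arc o (inj₂ y) w)) ⊎
      (∃[ w ] (Arc o w (inj₂ x) × Arc o w (inj₂ y)))
    common-neighbour true  p = inj₂ (inj₁ i , p , trans (sym e) p)
    common-neighbour false p = inj₁ (inj₁ i , p , trans (sym e) p)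

niche-inj₁-inj₂ : (o : Orientation m n) (a : Fin m) (x : Fin n) →
  ¬ NicheGraph (Arc o) (inj₁ a) (inj₂ x)
niche-inj₁-inj₂ o a x (_ , inj₁ (inj₁ _ , () , _))
niche-inj₁-inj₂ o a x (_ , inj₁ (inj₂ _ , _ , ()))
niche-inj₁-inj₂ o a x (_ , inj₂ (inj₁ _ , () , _))
niche-inj₁-inj₂ o a x (_ , inj₂ (inj₂ _ , _ , ()))

niche-inj₂-inj₁ : (o : Orientation m n) (x : Fin n) (a : Fin m) →
  ¬ NicheGraph (Arc o) (inj₂ x) (inj₁ a)
niche-inj₂-inj₁ o x a (_ , inj₁ (inj₁ _ , _ , ()))
niche-inj₂-inj₁ o x a (_ , inj₁ (inj₂ _ , () , _))
niche-inj₂-inj₁ o x a (_ , inj₂ (inj₁ _ , _ , ()))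
niche-inj₂-inj₁ o x a (_ , inj₂ (inj₂ _ , () , _))

nicheRealizable⇔agreementGraphs : (G₁ : Graph (Fin m)) (G₂ : Graph (Fin n)) →
  NicheRealizable G₁ G₂ ⇔
  (∃[ o ] (AgreementGraph o G₁ × AgreementGraph (flip o) G₂))
nicheRealizable⇔agreementGraphs G₁ G₂ = mk⇔ to′ from′
  where
  to′ : NicheRealizable G₁ G₂ →
        ∃[ o ] (AgreementGraph o G₁ × AgreementGraph (flip o) G₂)
  to′ (o , h) = o
    , (λ a b → h (inj₁ a) (inj₁ b) ⇔-∘ ⇔-sym (niche-inj₁ o a b))
    , (λ x y → h (inj₂ x) (inj₂ y) ⇔-∘ ⇔-sym (niche-inj₂ o x y))
  from′ : ∃[ o ] (AgreementGraph o G₁ × AgreementGraph (flip o) G₂) →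
          NicheRealizable G₁ G₂
  from′ (o , h₁ , h₂) = o , h
    where
    h : ∀ u v → NicheGraph (Arc o) u v ⇔ DisjointUnion G₁ G₂ u v
    h (inj₁ a) (inj₁ b) = h₁ a b ⇔-∘ niche-inj₁ o a b
    h (inj₂ x) (inj₂ y) = h₂ x y ⇔-∘ niche-inj₂ o x y
    h (inj₁ a) (inj₂ x) = mk⇔ (niche-inj₁-inj₂ o a x) ⊥-elim
    h (inj₂ x) (inj₁ a) = mk⇔ (niche-inj₂-inj₁ o x a) ⊥-elim

agreementGraph-¬Cycle : ∀ {k} → 5 ≤ k → {f : Fin k → B → Bool} →
  ¬ AgreementGraph f (Cycle k)
agreementGraph-¬Cycle (s≤s (s≤s (s≤s (s≤s (s≤s _))))) {f} h =
  Agree⇒¬Complementary {f = f} (from (h (# 1) (# 2)) (inj₁ refl))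
    (complementary-zigzag {f = f}
      (complementary (# 0) (# 2) (λ ()) 0≁2)
      (complementary (# 0) (# 3) (λ ()) 0≁3)
      (complementary (# 1) (# 3) (λ ()) 1≁3))
  where
  complementary : ∀ a b → a ≢ b → ¬ Cycle _ a b → Complementary f a b
  complementary a b a≢b ¬ab = ¬Agree⇒Complementary a≢b (¬ab ∘ to (h a b))

  0≁2 : ¬ Cycle _ (# 0) (# 2)
  0≁2 (inj₁ ())
  0≁2 (inj₂ (inj₁ ()))
  0≁2 (inj₂ (inj₂ (inj₁ (_ , ()))))
  0≁2 (inj₂ (inj₂ (inj₂ (() , _))))

  0≁3 : ¬ Cycle _ (# 0) (# 3)
  0≁3 (inj₁ ())
  0≁3 (inj₂ (inj₁ ()))
  0≁3 (inj₂ (inj₂ (inj₁ (_ , ()))))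
  0≁3 (inj₂ (inj₂ (inj₂ (() , _))))

  1≁3 : ¬ Cycle _ (# 1) (# 3)
  1≁3 (inj₁ ())
  1≁3 (inj₂ (inj₁ ()))
  1≁3 (inj₂ (inj₂ (inj₁ (() , _))))
  1≁3 (inj₂ (inj₂ (inj₂ (() , _))))

agreementGraph-Cycle⇒≤4 : ∀ {k} {f : Fin k → B → Bool} →
  AgreementGraph f (Cycle k) → k ≤ 4
agreementGraph-Cycle⇒≤4 {k = k} h =
  decidable-stable (k ℕ.≤? 4) (λ k≰4 → agreementGraph-¬Cycle (≰⇒> k≰4) h)

nicheRealizable-Cycle⇒≤4 : NicheRealizable (Cycle m) (Cycle n) → m ≤ 4 × n ≤ 4
nicheRealizable-Cycle⇒≤4 r
  with _ , h₁ , h₂ ← to (nicheRealizable⇔agreementGraphs _ _) r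
  = agreementGraph-Cycle⇒≤4 h₁ , agreementGraph-Cycle⇒≤4 h₂

_⇔?_ : Dec A → Dec B → Dec (A ⇔ B)
a? ⇔? b? = map′ (λ (f , g) → mk⇔ f g) (λ e → to e , from e)
  ((a? →-dec b?) ×-dec (b? →-dec a?))

cycle? : ∀ k → Decidable (Cycle k)
cycle? k i j = (suc (toℕ i) ℕ.≟ toℕ j) ⊎-dec (suc (toℕ j) ℕ.≟ toℕ i)
  ⊎-dec ((toℕ i ℕ.≟ 0) ×-dec (suc (toℕ j) ℕ.≟ k))
  ⊎-dec ((toℕ j ℕ.≟ 0) ×-dec (suc (toℕ i) ℕ.≟ k))

agree? : (f : Fin m → Fin n → Bool) → Decidable (Agree f)
agree? f a b = ¬? (a ≟ᶠ b) ×-dec any? (λ y → f a y ≟ᵇ f b y)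

agreementGraph? : (f : Fin m → Fin n → Bool) {G : Graph (Fin m)} →
  Decidable G → Dec (AgreementGraph f G)
agreementGraph? f G? = all? λ a → all? λ b → agree? f a b ⇔? G? a b

nicheRealizable-Cycle-by : (o : Orientation m n) →
  True (agreementGraph? o (cycle? m) ×-dec agreementGraph? (flip o) (cycle? n)) →
  NicheRealizable (Cycle m) (Cycle n)
nicheRealizable-Cycle-by o p =
  from (nicheRealizable⇔agreementGraphs _ _) (o , toWitness p)

fromRows : Vec (Vec Bool n) m → Orientation m n
fromRows rows i j = lookup (lookup rows i) j

nicheRealizable-C₃-C₃ : NicheRealizable (Cycle 3) (Cycle 3)
nicheRealizable-C₃-C₃ = nicheRealizable-Cycle-by (fromRows
  ( (true ∷ true ∷ true ∷ [])
  ∷ (true ∷ true ∷ true ∷ [])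
  ∷ (true ∷ true ∷ true ∷ [])
  ∷ [])) _

nicheRealizable-C₃-C₄ : NicheRealizable (Cycle 3) (Cycle 4)
nicheRealizable-C₃-C₄ = nicheRealizable-Cycle-by (fromRows
  ( (true ∷ true  ∷ false ∷ false ∷ [])
  ∷ (true ∷ true  ∷ false ∷ false ∷ [])
  ∷ (true ∷ false ∷ false ∷ true  ∷ [])
  ∷ [])) _

nicheRealizable-C₄-C₃ : NicheRealizable (Cycle 4) (Cycle 3)
nicheRealizable-C₄-C₃ = nicheRealizable-Cycle-by (fromRows
  ( (true  ∷ true  ∷ true  ∷ [])
  ∷ (true  ∷ true  ∷ false ∷ [])
  ∷ (false ∷ false ∷ false ∷ [])
  ∷ (false ∷ false ∷ true  ∷ [])
  ∷ [])) _

nicheRealizable-C₄-C₄ : NicheRealizable (Cycle 4) (Cycle 4)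
nicheRealizable-C₄-C₄ = nicheRealizable-Cycle-by (fromRows
  ( (true  ∷ true  ∷ false ∷ false ∷ [])
  ∷ (true  ∷ false ∷ false ∷ true  ∷ [])
  ∷ (false ∷ false ∷ true  ∷ true  ∷ [])
  ∷ (false ∷ true  ∷ true  ∷ false ∷ [])
  ∷ [])) _

3≤k≤4⇒k≡3⊎k≡4 : ∀ {k} → 3 ≤ k → k ≤ 4 → k ≡ 3 ⊎ k ≡ 4
3≤k≤4⇒k≡3⊎k≡4 3≤k k≤4 with m≤n⇒m<n∨m≡n k≤4
... | inj₁ k<4 = inj₁ (≤-antisym (≤-pred k<4) 3≤k)
... | inj₂ k≡4 = inj₂ k≡4

corollary3p9 : (m n : ℕ) → 3 ≤ m → 3 ≤ n →
    NicheRealizable (Cycle m) (Cycle n)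
      ⇔ ((m ≡ 3 × n ≡ 3) ⊎ (m ≡ 3 × n ≡ 4) ⊎ (m ≡ 4 × n ≡ 3) ⊎ (m ≡ 4 × n ≡ 4))
corollary3p9 m n 3≤m 3≤n = mk⇔ only-small small-realizable
  where
  only-small : NicheRealizable (Cycle m) (Cycle n) →
    (m ≡ 3 × n ≡ 3) ⊎ (m ≡ 3 × n ≡ 4) ⊎ (m ≡ 4 × n ≡ 3) ⊎ (m ≡ 4 × n ≡ 4)
  only-small r with m≤4 , n≤4 ← nicheRealizable-Cycle⇒≤4 r
    with 3≤k≤4⇒k≡3⊎k≡4 3≤m m≤4 | 3≤k≤4⇒k≡3⊎k≡4 3≤n n≤4
  ... | inj₁ m≡3 | inj₁ n≡3 = inj₁ (m≡3 , n≡3)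
  ... | inj₁ m≡3 | inj₂ n≡4 = inj₂ (inj₁ (m≡3 , n≡4))
  ... | inj₂ m≡4 | inj₁ n≡3 = inj₂ (inj₂ (inj₁ (m≡4 , n≡3)))
  ... | inj₂ m≡4 | inj₂ n≡4 = inj₂ (inj₂ (inj₂ (m≡4 , n≡4)))

  small-realizable :
    (m ≡ 3 × n ≡ 3) ⊎ (m ≡ 3 × n ≡ 4) ⊎ (m ≡ 4 × n ≡ 3) ⊎ (m ≡ 4 × n ≡ 4) →
    NicheRealizable (Cycle m) (Cycle n)
  small-realizable (inj₁ (refl , refl))               = nicheRealizable-C₃-C₃
  small-realizable (inj₂ (inj₁ (refl , refl)))        = nicheRealizable-C₃-C₄
  small-realizable (inj₂ (inj₂ (inj₁ (refl , refl)))) = nicheRealizable-C₄-C₃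
  small-realizable (inj₂ (inj₂ (inj₂ (refl , refl)))) = nicheRealizable-C₄-C₄
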